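{- Let $C$ be the applicability condition of an inference rule in a well-behaved defeasible logic. Then $C\wedge\mathrm{sneg}(C)$ is proof-unsatisfiable.
   Context: A defeasible theory $D=(F,R,>)$ consists of a finite set $F$ of literals, a finite set $R$ of rules (each with a finite antecedent set of literals, a type strict/defeasible/defeater and a consequent literal) and an acyclic relation $>$ on $R$. Conclusions have the form $+d\,q$ or $-d\,q$. A defeasible logic is a finite set of inference rules "We may append $\pm d\,q$ to $P$ if $C$", one per tag; a proof from $D$ is a finite sequence of conclusions each appendable by some rule to the sequence preceding it. An applicability condition $C(D,q,P)$ is a first-order formula in negation normal form (negation only on atomic formulas; connectives $\wedge,\vee,\exists,\forall$) whose atomic formulas are pure atomic formulas (comparisons of elements of $D$, arithmetic and set comparisons; no tagged literals) or proof atomic formulas $\pm d'p\in X$ with $X$ either the current proof $P$ or a pre-defined set of conclusions computed from $D$; $c\notin X$ abbreviates $\neg(c\in X)$. Strong negation: $\mathrm{sneg}(+d p\in X)= -dp\in X$; $\mathrm{sneg}(-dp\in X)=+dp\in X$; $\mathrm{sneg}(+dp\notin X)=+dp\in X$; $\mathrm{sneg}(-dp\notin X)=-dp\in X$; $\mathrm{sneg}(A\wedge B)=\mathrm{sneg}(A)\vee\mathrm{sneg}(B)$; $\mathrm{sneg}(A\vee B)=\mathrm{sneg}(A)\wedge\mathrm{sneg}(B)$; $\mathrm{sneg}(\exists x\,A)=\forall x\,\mathrm{sneg}(A)$; $\mathrm{sneg}(\forall x\,A)=\exists x\,\mathrm{sneg}(A)$; $\mathrm{sneg}(\neg A)=A$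 and $\mathrm{sneg}(A)=\neg A$ for pure atomic $A$. The logic supports the (revised) Principle of Strong Negation if for every tag $d$, when the $+d$ rule has condition $C$, the $-d$ rule has condition $\mathrm{sneg}(C)$. An inference rule is stable if for every proof $P$ and every proof $Q$ containing $P$ as a subsequence, $C(P)\rightarrow C(Q)$. For a set $J$ of rules with $I$ the smallest set of rules containing $J$ and closed under the rules' references to tags, the $J$-closure is the set of conclusions with tags in $J$ in the smallest set of conclusions closed under inference by rules of $I$; it is even-handed if $J$ contains the $-d$ rule iff it contains the $+d$ rule. A set of conclusions is coherent if it contains no pair $+dq,-dq$. The logic is well-behaved if all its rules are stable, it supports the revised Principle of Strong Negation, and all pre-defined sets used in its rules are coherent even-handed closures. A formula $\psi(D,q,P)$ is proof-satisfiable if there exist $D$, a literal $q$ and a proof $P$ from $D$ with $\psi(D,q,P)$ true; proof-unsatisfiable otherwise. -}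

module Defs where

open import Data.Nat using (ℕ)
open import Data.Bool using (Bool)
open import Data.Fin using (Fin)
open import Data.List using (List; length; lookup; take)
open import Data.List.Membership.Propositional using (_∈_)
open import Data.List.Relation.Binary.Sublist.Propositional using (_⊆_)
open import Data.Product using (Σ; _×_; _,_; ∃)
open import Data.Unit using (⊤; tt)
open import Data.Sum using (_⊎_)
open import Data.Fin using (toℕ)
open import Relation.Nullary using (¬_)
open import Relation.Binary.PropositionalEquality using (_≡_)
open import Relation.Binary.Construct.Closure.Transitive using (TransClosure)

-- A literal: an atom (ℕ) with a polarity (true = positive, false = negated).
record Literal : Set where
  constructor mkLit
  field
    polarity : Bool
    atom     : ℕ

data RuleType : Set where
  strict defeasible defeater : RuleType

record Rule : Set where
  constructor mkRule
  field
    antecedent : List Literal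
    type       : RuleType
    consequent : Literal

record Theory : Set where
  constructor mkTheory
  field
    facts : List Literal
    rules : List Rule
    -- superiority relation on the rules of R (by position in the list)
    sup   : List (Fin (length rules) × Fin (length rules))

Sup : (D : Theory) → Fin (length (Theory.rules D)) → Fin (length (Theory.rules D)) → Set
Sup D i j = (i , j) ∈ Theory.sup D

ValidTheory : Theory → Set
ValidTheory D = ∀ i → ¬ TransClosure (Sup D) i i

data Sign : Set where
  plus minus : Sign

record Conclusion (k : ℕ) : Set where
  constructor concl
  field
    sign : Sign
    tag  : Fin k
    literal : Literal

Proof : ℕ → Set
Proof k = List (Conclusion k)

-- Applicability conditions: first-order formulas in negation normal form.
-- Ctx: the type of variable assignments, which may depend on D and q.
Ctx : Set₁
Ctx = Theory → Literal → Set

-- Where a proof atom looks: the current proof P or a pre-defined set X.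
data Target (SName : Set) : Set where
  P   : Target SName
  set : SName → Target SName

data Form (k : ℕ) (SName : Set) (Γ : Ctx) : Set₁ where
  pure    : ((D : Theory) (q : Literal) → Γ D q → Set) → Form k SName Γ
  ¬pure   : ((D : Theory) (q : Literal) → Γ D q → Set) → Form k SName Γ
  -- proof atomic formulas  ±d' p ∈ X  and  ±d' p ∉ X
  mem     : Sign → Fin k → Target SName →
            ((D : Theory) (q : Literal) → Γ D q → Literal) → Form k SName Γ
  nmem    : Sign → Fin k → Target SName →
            ((D : Theory) (q : Literal) → Γ D q → Literal) → Form k SName Γ
  _∧ᶠ_ _∨ᶠ_ : Form k SName Γ → Form k SName Γ → Form k SName Γ
  ∃ᶠ ∀ᶠ   : (A : (D : Theory) (q : Literal) → Γ D q → Set) →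
            Form k SName (λ D q → Σ (Γ D q) (A D q)) → Form k SName Γ

-- Closed formulas C(D, q, P): no free variables.
Ctx₀ : Ctx
Ctx₀ _ _ = ⊤

Cond : ℕ → Set → Set₁
Cond k SName = Form k SName Ctx₀

sneg : ∀ {k SName Γ} → Form k SName Γ → Form k SName Γ
sneg (pure a)          = ¬pure a
sneg (¬pure a)         = pure a
sneg (mem plus d X t)  = mem minus d X t
sneg (mem minus d X t) = mem plus d X t
sneg (nmem s d X t)    = mem s d X t
sneg (φ ∧ᶠ ψ)          = sneg φ ∨ᶠ sneg ψ
sneg (φ ∨ᶠ ψ)          = sneg φ ∧ᶠ sneg ψ
sneg (∃ᶠ A φ)          = ∀ᶠ A (sneg φ)
sneg (∀ᶠ A φ)          = ∃ᶠ A (sneg φ)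

data RefsTag {k SName} : ∀ {Γ} → Form k SName Γ → Fin k → Set₁ where
  mem  : ∀ {Γ s d X t} → RefsTag {Γ = Γ} (mem s d X t) d
  nmem : ∀ {Γ s d X t} → RefsTag {Γ = Γ} (nmem s d X t) d
  ∧l   : ∀ {Γ} {φ ψ : Form k SName Γ} {d} → RefsTag φ d → RefsTag (φ ∧ᶠ ψ) d
  ∧r   : ∀ {Γ} {φ ψ : Form k SName Γ} {d} → RefsTag ψ d → RefsTag (φ ∧ᶠ ψ) d
  ∨l   : ∀ {Γ} {φ ψ : Form k SName Γ} {d} → RefsTag φ d → RefsTag (φ ∨ᶠ ψ) d
  ∨r   : ∀ {Γ} {φ ψ : Form k SName Γ} {d} → RefsTag ψ d → RefsTag (φ ∨ᶠ ψ) d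
  ∃i   : ∀ {Γ A φ d} → RefsTag φ d → RefsTag {Γ = Γ} (∃ᶠ A φ) d
  ∀i   : ∀ {Γ A φ d} → RefsTag φ d → RefsTag {Γ = Γ} (∀ᶠ A φ) d

data UsesSet {k SName} : ∀ {Γ} → Form k SName Γ → SName → Set₁ where
  mem  : ∀ {Γ s d X t} → UsesSet {Γ = Γ} (mem s d (set X) t) X
  nmem : ∀ {Γ s d X t} → UsesSet {Γ = Γ} (nmem s d (set X) t) X
  ∧l   : ∀ {Γ} {φ ψ : Form k SName Γ} {X} → UsesSet φ X → UsesSet (φ ∧ᶠ ψ) X
  ∧r   : ∀ {Γ} {φ ψ : Form k SName Γ} {X} → UsesSet ψ X → UsesSet (φ ∧ᶠ ψ) X
  ∨l   : ∀ {Γ} {φ ψ : Form k SName Γ} {X} → UsesSet φ X → UsesSet (φ ∨ᶠ ψ) X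
  ∨r   : ∀ {Γ} {φ ψ : Form k SName Γ} {X} → UsesSet ψ X → UsesSet (φ ∨ᶠ ψ) X
  ∃i   : ∀ {Γ A φ X} → UsesSet φ X → UsesSet {Γ = Γ} (∃ᶠ A φ) X
  ∀i   : ∀ {Γ A φ X} → UsesSet φ X → UsesSet {Γ = Γ} (∀ᶠ A φ) X

-- A defeasible logic: k tags, one inference rule per signed tag, each
-- with an applicability condition; pre-defined sets of conclusions
-- (named by SName) computed from D.

record Logic (k : ℕ) (SName : Set) : Set₁ where
  field
    cond    : Sign → Fin k → Cond k SName
    defined : SName → Theory → Conclusion k → Set

module _ {k : ℕ} {SName : Set} (L : Logic k SName) where
  open Logic L

  -- Truth of a formula, with the "proof" given as a set of conclusions.
  eval : ∀ {Γ} → Form k SName Γ → (D : Theory) (q : Literal) → Γ D q →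
         (Conclusion k → Set) → Set
  eval (pure a)       D q ρ S = a D q ρ
  eval (¬pure a)      D q ρ S = ¬ a D q ρ
  eval (mem s d P t)  D q ρ S = S (concl s d (t D q ρ))
  eval (mem s d (set X) t) D q ρ S = defined X D (concl s d (t D q ρ))
  eval (nmem s d P t) D q ρ S = ¬ S (concl s d (t D q ρ))
  eval (nmem s d (set X) t) D q ρ S = ¬ defined X D (concl s d (t D q ρ))
  eval (φ ∧ᶠ ψ)       D q ρ S = eval φ D q ρ S × eval ψ D q ρ S
  eval (φ ∨ᶠ ψ)       D q ρ S = eval φ D q ρ S ⊎ eval ψ D q ρ S
  eval (∃ᶠ A φ)       D q ρ S = Σ (A D q ρ) λ a → eval φ D q (ρ , a) S
  eval (∀ᶠ A φ)       D q ρ S = (a : A D q ρ) → eval φ D q (ρ , a) S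

  Holds : Cond k SName → Theory → Literal → Proof k → Set
  Holds φ D q Pr = eval φ D q tt (_∈ Pr)

  Appendable : Theory → Proof k → Conclusion k → Set
  Appendable D Pr (concl s d q) = Holds (cond s d) D q Pr

  IsProof : Theory → Proof k → Set
  IsProof D Pr = (i : Fin (length Pr)) → Appendable D (take (toℕ i) Pr) (lookup Pr i)

  Stable : Sign → Fin k → Set
  Stable s d = ∀ (D : Theory) → ValidTheory D → ∀ (q : Literal) (Pr Qr : Proof k) →
    IsProof D Pr → IsProof D Qr → Pr ⊆ Qr →
    Holds (cond s d) D q Pr → Holds (cond s d) D q Qr

  StrongNegation : Set₁
  StrongNegation = ∀ (d : Fin k) → cond minus d ≡ sneg (cond plus d)

  -- Sets of rules (rules are identified by their signed tag).
  RuleSet : Set₁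
  RuleSet = Sign → Fin k → Set

  EvenHanded : RuleSet → Set
  EvenHanded J = ∀ d → (J plus d → J minus d) × (J minus d → J plus d)

  data InI (J : RuleSet) : Sign → Fin k → Set₁ where
    base : ∀ {s d} → J s d → InI J s d
    ref  : ∀ {s d d'} → InI J s d → RefsTag (cond s d) d' → ∀ s' → InI J s' d'

  ClosedUnder : (Sign → Fin k → Set₁) → Theory → (Conclusion k → Set) → Set₁
  ClosedUnder I D S = ∀ s d q → I s d → eval (cond s d) D q tt S → S (concl s d q)

  InLeastClosed : (Sign → Fin k → Set₁) → Theory → Conclusion k → Set₁
  InLeastClosed I D c = ∀ (S : Conclusion k → Set) → ClosedUnder I D S → S c

  InJClosure : RuleSet → Theory → Conclusion k → Set₁
  InJClosure J D c = InLeastClosed (InI J) D c ×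
                     J (Conclusion.sign c) (Conclusion.tag c)

  Coherent : (Conclusion k → Set) → Set
  Coherent S = ∀ d q → ¬ (S (concl plus d q) × S (concl minus d q))

  CoherentEvenHandedClosure : SName → Set₁
  CoherentEvenHandedClosure X =
    Σ RuleSet λ J → EvenHanded J ×
      (∀ (D : Theory) → ValidTheory D →
         Coherent (defined X D) ×
         (∀ c → (defined X D c → InJClosure J D c) × (InJClosure J D c → defined X D c)))

  record WellBehaved : Set₁ where
    field
      stable     : ∀ s d → Stable s d
      strongNeg  : StrongNegation
      predefined : ∀ X → (Σ Sign λ s → Σ (Fin k) λ d → UsesSet (cond s d) X) →
                   CoherentEvenHandedClosure X

  ProofSatisfiable : Cond k SName → Set
  ProofSatisfiable ψ = Σ Theory λ D → ValidTheory D × Σ Literal λ q → Σ (Proof k) λ Pr →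
    IsProof D Pr × Holds ψ D q Pr

  ProofUnsatisfiable : Cond k SName → Set
  ProofUnsatisfiable ψ = ¬ ProofSatisfiable ψ

-- A formula and its strong negation cannot both hold over a coherent set of
-- conclusions when the pre-defined sets it mentions are coherent. So it suffices
-- that every proof is coherent. If +d q and -d q both occur in a proof, C held on
-- the prefix before the first and sneg C on the prefix before the second; by
-- stability both hold on the longer of the two prefixes, a shorter proof, which is
-- coherent by induction on length.
module Submission where

open import Defs
open import Data.Nat using (ℕ; _≤_; _<_; _⊔_)
open import Data.Nat.Properties using (m≤m⊔n; m≤n⊔m; ⊔-pres-<m; m<n⇒m⊓o<n)
open import Data.Nat.Induction using (<-wellFounded)
open import Data.Fin using (Fin; toℕ; zero; suc)
open import Data.Fin.Properties using (toℕ<n)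
open import Data.List using (List; _∷_; length; lookup; take)
open import Data.List.Properties using (length-take)
open import Data.List.Membership.Propositional using (_∈_)
open import Data.List.Relation.Unary.Any using (index)
open import Data.List.Relation.Unary.Any.Properties using (lookup-index)
open import Data.List.Relation.Binary.Pointwise using (≡⇒Pointwise-≡)
open import Data.List.Relation.Binary.Sublist.Propositional using (_⊆_)
open import Data.List.Relation.Binary.Sublist.Heterogeneous.Properties using (take⁺)
open import Data.Product using (Σ; ∃; _×_; _,_; proj₁; proj₂)
open import Data.Sum using (inj₁; inj₂)
open import Data.Empty using (⊥)
open import Induction.WellFounded using (Acc; acc)
open import Relation.Binary.PropositionalEquality using (_≡_; refl; sym; cong; subst; subst₂)

module _ {A : Set} where

  take-⊆-take : ∀ {m n} (xs : List A) → m ≤ n → take m xs ⊆ take n xs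
  take-⊆-take xs m≤n = take⁺ m≤n (≡⇒Pointwise-≡ refl)

  length-take-< : ∀ {n} (xs : List A) → n < length xs → length (take n xs) < length xs
  length-take-< {n} xs n<len =
    subst (_< length xs) (sym (length-take n xs)) (m<n⇒m⊓o<n (length xs) n<len)

  lookup-take : ∀ n (xs : List A) (i : Fin (length (take n xs))) →
    ∃ λ j → take (toℕ i) (take n xs) ≡ take (toℕ j) xs × lookup (take n xs) i ≡ lookup xs j
  lookup-take (ℕ.suc n) (x ∷ xs) zero    = zero , refl , refl
  lookup-take (ℕ.suc n) (x ∷ xs) (suc i) with lookup-take n xs i
  ... | j , prefix≡ , lookup≡ = suc j , cong (x ∷_) prefix≡ , lookup≡

module _ {k : ℕ} {SName : Set} (L : Logic k SName) where
  open Logic L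

  UsedSetsCoherent : ∀ {Γ} → Form k SName Γ → Theory → Set₁
  UsedSetsCoherent φ D = ∀ X → UsesSet φ X → Coherent L (defined X D)

  sneg-exclusive : ∀ {Γ} (φ : Form k SName Γ) {D q ρ} {S : Conclusion k → Set} →
    Coherent L S → UsedSetsCoherent φ D →
    eval L φ D q ρ S → eval L (sneg φ) D q ρ S → ⊥
  sneg-exclusive (pure a)               cohS cohX h ¬h = ¬h h
  sneg-exclusive (¬pure a)              cohS cohX ¬h h = ¬h h
  sneg-exclusive (mem plus d P t)       cohS cohX h₊ h₋ = cohS d _ (h₊ , h₋)
  sneg-exclusive (mem minus d P t)      cohS cohX h₋ h₊ = cohS d _ (h₊ , h₋)
  sneg-exclusive (mem plus d (set X) t)  cohS cohX h₊ h₋ = cohX X mem d _ (h₊ , h₋)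
  sneg-exclusive (mem minus d (set X) t) cohS cohX h₋ h₊ = cohX X mem d _ (h₊ , h₋)
  sneg-exclusive (nmem s d P t)         cohS cohX ¬h h = ¬h h
  sneg-exclusive (nmem s d (set X) t)   cohS cohX ¬h h = ¬h h
  sneg-exclusive (φ ∧ᶠ ψ) cohS cohX (hφ , hψ) (inj₁ h) =
    sneg-exclusive φ cohS (λ X u → cohX X (∧l u)) hφ h
  sneg-exclusive (φ ∧ᶠ ψ) cohS cohX (hφ , hψ) (inj₂ h) =
    sneg-exclusive ψ cohS (λ X u → cohX X (∧r u)) hψ h
  sneg-exclusive (φ ∨ᶠ ψ) cohS cohX (inj₁ hφ) (h , _) =
    sneg-exclusive φ cohS (λ X u → cohX X (∨l u)) hφ h
  sneg-exclusive (φ ∨ᶠ ψ) cohS cohX (inj₂ hψ) (_ , h) =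
    sneg-exclusive ψ cohS (λ X u → cohX X (∨r u)) hψ h
  sneg-exclusive (∃ᶠ A φ) cohS cohX (a , hφ) h =
    sneg-exclusive φ cohS (λ X u → cohX X (∃i u)) hφ (h a)
  sneg-exclusive (∀ᶠ A φ) cohS cohX hφ (a , h) =
    sneg-exclusive φ cohS (λ X u → cohX X (∀i u)) (hφ a) h

  IsProof-take : ∀ {D} n {Pr} → IsProof L D Pr → IsProof L D (take n Pr)
  IsProof-take {D} n {Pr} isProof i with lookup-take n Pr i
  ... | j , prefix≡ , lookup≡ =
    subst₂ (Appendable L D) (sym prefix≡) (sym lookup≡) (isProof j)

  ∈-appended : ∀ {D Pr c} → IsProof L D Pr → c ∈ Pr →
    Σ (Fin (length Pr)) λ i → Appendable L D (take (toℕ i) Pr) c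
  ∈-appended {D} {Pr} isProof c∈Pr =
    index c∈Pr , subst (Appendable L D _) (sym (lookup-index c∈Pr)) (isProof (index c∈Pr))

module _ {k : ℕ} {SName : Set} {L : Logic k SName} (wb : WellBehaved L) where
  open Logic L
  open WellBehaved wb

  cond-sets-coherent : ∀ s d {D} → ValidTheory D → UsedSetsCoherent L (cond s d) D
  cond-sets-coherent s d valid X u = proj₁ (proj₂ (proj₂ (predefined X (s , d , u))) _ valid)

  Holds-take-mono : ∀ {s d D q Pr m n} → ValidTheory D → IsProof L D Pr → m ≤ n →
    Holds L (cond s d) D q (take m Pr) → Holds L (cond s d) D q (take n Pr)
  Holds-take-mono {s} {d} {D} {q} {Pr} {m} {n} valid isProof m≤n =
    stable s d D valid q _ _ (IsProof-take L m isProof) (IsProof-take L n isProof)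
      (take-⊆-take Pr m≤n)

  proof-coherent : ∀ {D Pr} → ValidTheory D → IsProof L D Pr → Coherent L (_∈ Pr)
  proof-coherent {D} {Pr} valid isProof = go Pr isProof (<-wellFounded (length Pr))
    where
    go : ∀ Pr → IsProof L D Pr → Acc _<_ (length Pr) → Coherent L (_∈ Pr)
    go Pr isProof (acc shorter) d q (+dq∈Pr , -dq∈Pr)
      with ∈-appended L isProof +dq∈Pr | ∈-appended L isProof -dq∈Pr
    ... | i , +holds | j , -holds =
      sneg-exclusive L (cond plus d) prefix-coherent (cond-sets-coherent plus d valid)
        (Holds-take-mono valid isProof (m≤m⊔n (toℕ i) (toℕ j)) +holds)
        (subst (λ C → Holds L C D q prefix) (strongNeg d)
          (Holds-take-mono valid isProof (m≤n⊔m (toℕ i) (toℕ j)) -holds))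
      where
      n = toℕ i ⊔ toℕ j
      prefix = take n Pr
      prefix-coherent : Coherent L (_∈ prefix)
      prefix-coherent = go prefix (IsProof-take L n isProof)
        (shorter (length-take-< Pr (⊔-pres-<m (toℕ<n i) (toℕ<n j))))

corollary2 : (k : ℕ) (SName : Set) (L : Logic k SName) → WellBehaved L →
    (s : Sign) (d : Fin k) →
    ProofUnsatisfiable L (Logic.cond L s d ∧ᶠ sneg (Logic.cond L s d))
corollary2 k SName L wb s d (D , valid , q , Pr , isProof , holds , sneg-holds) =
  sneg-exclusive L (Logic.cond L s d)
    (proof-coherent wb valid isProof) (cond-sets-coherent wb s d valid) holds sneg-holds
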